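{- Let $G$ be a graph and $S,T \subseteq V(G)$. If $P \subseteq V(G)$ is a minimum left-restricted $(S,T)$-separator in $G$ and $S' = R_G(S,P)$, then for any set $C$ with $S \subseteq C \subseteq V(G) \setminus T$ we have $|N_G(C \cup S')| \le |N_G(C)|$.
   Context: Graphs are finite, simple, undirected. $N_G(X)$ is the set of vertices outside $X$ adjacent to some vertex of $X$. For $S,T \subseteq V(G)$, a set $P \subseteq V(G)$ is an $(S,T)$-separator if every path from a vertex of $S$ to a vertex of $T$ contains a vertex of $P$; it is left-restricted if moreover $P \cap S = \emptyset$; it is a minimum left-restricted $(S,T)$-separator if it has minimum size among left-restricted $(S,T)$-separators. $R_G(S,P)$ is the set of vertices reachable in $G - P$ from at least one vertex of $S \setminus P$. -}

module Defs where

open import Data.Nat using (ℕ; _≤_)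
open import Data.Bool using (Bool; true; false; _∧_; _∨_; not)
open import Data.Fin using (Fin; zero; suc)
open import Data.Fin.Subset using (Subset; _∈_; _∉_; ∣_∣)
open import Data.Vec using (tabulate; lookup)
open import Data.List using (List; []; _∷_)
open import Data.List.Relation.Unary.All using (All)
open import Data.List.Relation.Unary.Any using (Any)
open import Data.List.Relation.Unary.Linked using (Linked)
open import Data.List.Relation.Unary.Unique.Propositional using (Unique)
open import Data.Product using (Σ; _×_)
open import Relation.Binary.PropositionalEquality using (_≡_)

record Graph (n : ℕ) : Set where
  field
    adj   : Fin n → Fin n → Bool
    sym   : ∀ u v → adj u v ≡ adj v u
    irref : ∀ v → adj v v ≡ false
open Graph public

Adj : ∀ {n} → Graph n → Fin n → Fin n → Set
Adj G u v = adj G u v ≡ true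

anyFin : ∀ {n} → (Fin n → Bool) → Bool
anyFin {ℕ.zero} f = false
anyFin {ℕ.suc n} f = f zero ∨ anyFin (λ i → f (suc i))

N : ∀ {n} → Graph n → Subset n → Subset n
N G X = tabulate λ v → not (lookup X v) ∧ anyFin (λ u → lookup X u ∧ adj G u v)

endpoint : ∀ {n} → Fin n → List (Fin n) → Fin n
endpoint x [] = x
endpoint x (y ∷ ys) = endpoint y ys

IsPath : ∀ {n} → Graph n → Fin n → List (Fin n) → Set
IsPath G s vs = Linked (Adj G) (s ∷ vs) × Unique (s ∷ vs)

Separator : ∀ {n} → Graph n → Subset n → Subset n → Subset n → Set
Separator {n} G S T P =
  ∀ (s : Fin n) (vs : List (Fin n)) → s ∈ S → IsPath G s vs →
    endpoint s vs ∈ T → Any (_∈ P) (s ∷ vs)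

LeftRestrictedSeparator : ∀ {n} → Graph n → Subset n → Subset n → Subset n → Set
LeftRestrictedSeparator G S T P = Separator G S T P × (∀ v → v ∈ P → v ∉ S)

MinLeftRestrictedSeparator : ∀ {n} → Graph n → Subset n → Subset n → Subset n → Set
MinLeftRestrictedSeparator G S T P =
  LeftRestrictedSeparator G S T P ×
  (∀ Q → LeftRestrictedSeparator G S T Q → ∣ P ∣ ≤ ∣ Q ∣)

-- v ∈ R_G(S,P): v reachable in G - P from some vertex of S \ P
Reach : ∀ {n} → Graph n → Subset n → Subset n → Fin n → Set
Reach {n} G S P v =
  Σ (Fin n) λ s → Σ (List (Fin n)) λ vs →
    s ∈ S × s ∉ P × IsPath G s vs × All (_∉ P) (s ∷ vs) × endpoint s vs ≡ v

-- |N| is submodular: |N(C ∪ D)| + |N(C ∩ D)| ≤ |N(C)| + |N(D)|.  Apply this with D = S′.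
-- Every vertex of N(S′) lies in P, since otherwise it would be reachable from S in G − P;
-- so |N(S′)| ≤ |P|.  And C ∩ S′ contains S and avoids T, so N(C ∩ S′) is a left-restricted
-- (S,T)-separator and minimality gives |P| ≤ |N(C ∩ S′)|.  Cancelling |N(C ∩ S′)| leaves
-- |N(C ∪ S′)| ≤ |N(C)|.
module Submission where

open import Defs hiding (sym)
open import Data.Bool using (Bool; true; false; _∧_; _∨_; not)
open import Data.Bool.Properties using (∨-zeroʳ)
open import Data.Empty using (⊥-elim)
open import Data.Fin using (Fin; zero; suc; _≟_)
open import Data.Fin.Subset using (Subset; _∈_; _∉_; _⊆_; _∪_; _∩_; ∣_∣; inside; outside)
open import Data.Fin.Subset.Properties
  using (_∈?_; p⊆q⇒∣p∣≤∣q∣; p⊆p∪q; q⊆p∪q; x∈p∪q⁺; x∈p∪q⁻; x∈p∩q⁺; x∈p∩q⁻)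
open import Data.List using ([]; _∷_; _++_; [_])
open import Data.List.Relation.Unary.All using (All; []; _∷_)
open import Data.List.Relation.Unary.All.Properties using (++⁺; anti-mono)
import Data.List.Relation.Binary.Subset.Propositional as L
open import Data.List.Relation.Unary.AllPairs using ([]; _∷_)
open import Data.List.Relation.Unary.Any using (Any; here; there; any?)
open import Data.List.Relation.Unary.Linked using (Linked; [-]; _∷_)
open import Data.Nat using (ℕ; _≤_; _+_; suc)
open import Data.Nat.Properties using (+-suc; +-mono-≤; +-monoʳ-≤; +-cancelʳ-≤; module ≤-Reasoning)
open import Data.Product using (∃-syntax; _×_; _,_; proj₁)
open import Data.Sum using (inj₁; inj₂)
open import Data.Vec using ([]; _∷_; lookup)
open import Data.Vec.Properties using (lookup∘tabulate; []=⇒lookup; lookup⇒[]=)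
open import Function using (_∘_)
open import Function.Bundles using (_⇔_; Equivalence)
open import Relation.Binary.PropositionalEquality using (_≡_; refl; sym; trans; cong; cong₂; module ≡-Reasoning)
open import Relation.Nullary using (¬_; yes; no)

∣p∪q∣+∣p∩q∣≡∣p∣+∣q∣ : ∀ {n} (p q : Subset n) → ∣ p ∪ q ∣ + ∣ p ∩ q ∣ ≡ ∣ p ∣ + ∣ q ∣
∣p∪q∣+∣p∩q∣≡∣p∣+∣q∣ [] [] = refl
∣p∪q∣+∣p∩q∣≡∣p∣+∣q∣ (outside ∷ p) (outside ∷ q) = ∣p∪q∣+∣p∩q∣≡∣p∣+∣q∣ p q
∣p∪q∣+∣p∩q∣≡∣p∣+∣q∣ (inside ∷ p) (outside ∷ q) = cong suc (∣p∪q∣+∣p∩q∣≡∣p∣+∣q∣ p q)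
∣p∪q∣+∣p∩q∣≡∣p∣+∣q∣ (outside ∷ p) (inside ∷ q) =
  trans (cong suc (∣p∪q∣+∣p∩q∣≡∣p∣+∣q∣ p q)) (sym (+-suc ∣ p ∣ ∣ q ∣))
∣p∪q∣+∣p∩q∣≡∣p∣+∣q∣ (inside ∷ p) (inside ∷ q) =
  cong suc (trans (+-suc ∣ p ∪ q ∣ ∣ p ∩ q ∣)
                  (trans (cong suc (∣p∪q∣+∣p∩q∣≡∣p∣+∣q∣ p q)) (sym (+-suc ∣ p ∣ ∣ q ∣))))

anyFin-intro : ∀ {n} (f : Fin n → Bool) u → f u ≡ true → anyFin f ≡ true
anyFin-intro f zero    fu = cong (_∨ anyFin (f ∘ suc)) fu
anyFin-intro f (suc u) fu =
  trans (cong (f zero ∨_) (anyFin-intro (f ∘ suc) u fu)) (∨-zeroʳ (f zero))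

anyFin-elim : ∀ {n} (f : Fin n → Bool) → anyFin f ≡ true → ∃[ u ] f u ≡ true
anyFin-elim {ℕ.zero}  f ()
anyFin-elim {ℕ.suc n} f any with f zero in f0
... | true  = zero , f0
... | false with anyFin-elim (f ∘ suc) any
...   | u , fu = suc u , fu

∧≡true⁻ : ∀ {a b} → a ∧ b ≡ true → a ≡ true × b ≡ true
∧≡true⁻ {true} {true} refl = refl , refl

∉⇒lookup≡false : ∀ {n} {x : Fin n} {p} → x ∉ p → lookup p x ≡ false
∉⇒lookup≡false {x = x} {p} x∉p with lookup p x in px
... | true  = ⊥-elim (x∉p (lookup⇒[]= x p px))
... | false = refl

module _ {n} (G : Graph n) where

  ∈N⁺ : ∀ {X u v} → v ∉ X → u ∈ X → Adj G u v → v ∈ N G X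
  ∈N⁺ {X} {u} {v} v∉X u∈X uv = lookup⇒[]= v (N G X) (begin
    lookup (N G X) v                                       ≡⟨ lookup∘tabulate _ v ⟩
    not (lookup X v) ∧ anyFin (λ w → lookup X w ∧ adj G w v) ≡⟨ cong₂ _∧_ (cong not (∉⇒lookup≡false v∉X))
                                                                   (anyFin-intro _ u (cong₂ _∧_ ([]=⇒lookup u∈X) uv)) ⟩
    true                                                   ∎)
    where open ≡-Reasoning

  ∈N⁻ : ∀ {X v} → v ∈ N G X → v ∉ X × ∃[ u ] (u ∈ X × Adj G u v)
  ∈N⁻ {X} {v} v∈N with ∧≡true⁻ (trans (sym (lookup∘tabulate _ v)) ([]=⇒lookup v∈N))
  ... | ¬Xv , any with anyFin-elim (λ w → lookup X w ∧ adj G w v) any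
  ...   | u , Xu∧uv with ∧≡true⁻ Xu∧uv
  ...     | Xu , uv = v∉X , u , lookup⇒[]= u X Xu , uv
    where
    v∉X : v ∉ X
    v∉X v∈X with trans (sym (cong not ([]=⇒lookup v∈X))) ¬Xv
    ... | ()

  N-∪∩⊆N∪N : ∀ C D → N G (C ∪ D) ∪ N G (C ∩ D) ⊆ N G C ∪ N G D
  N-∪∩⊆N∪N C D v∈ with x∈p∪q⁻ (N G (C ∪ D)) (N G (C ∩ D)) v∈
  ... | inj₁ v∈N∪ with ∈N⁻ v∈N∪
  ...   | v∉C∪D , u , u∈C∪D , uv with x∈p∪q⁻ C D u∈C∪D
  ...     | inj₁ u∈C = x∈p∪q⁺ (inj₁ (∈N⁺ (v∉C∪D ∘ p⊆p∪q D) u∈C uv))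
  ...     | inj₂ u∈D = x∈p∪q⁺ (inj₂ (∈N⁺ (v∉C∪D ∘ q⊆p∪q C D) u∈D uv))
  N-∪∩⊆N∪N C D v∈ | inj₂ v∈N∩ with ∈N⁻ v∈N∩
  ...   | v∉C∩D , u , u∈C∩D , uv with x∈p∩q⁻ C D u∈C∩D | _ ∈? C
  ...     | u∈C , _   | no v∉C  = x∈p∪q⁺ (inj₁ (∈N⁺ v∉C u∈C uv))
  ...     | _   , u∈D | yes v∈C = x∈p∪q⁺ (inj₂ (∈N⁺ (v∉C∩D ∘ x∈p∩q⁺ ∘ (v∈C ,_)) u∈D uv))

  N-∪∩⊆N∩N : ∀ C D → N G (C ∪ D) ∩ N G (C ∩ D) ⊆ N G C ∩ N G D
  N-∪∩⊆N∩N C D v∈ with x∈p∩q⁻ (N G (C ∪ D)) (N G (C ∩ D)) v∈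
  ... | v∈N∪ , v∈N∩ with proj₁ (∈N⁻ v∈N∪) | ∈N⁻ v∈N∩
  ...   | v∉C∪D | _ , u , u∈C∩D , uv with x∈p∩q⁻ C D u∈C∩D
  ...     | u∈C , u∈D = x∈p∩q⁺ ( ∈N⁺ (v∉C∪D ∘ p⊆p∪q D) u∈C uv
                              , ∈N⁺ (v∉C∪D ∘ q⊆p∪q C D) u∈D uv)

  N-submodular : ∀ C D → ∣ N G (C ∪ D) ∣ + ∣ N G (C ∩ D) ∣ ≤ ∣ N G C ∣ + ∣ N G D ∣
  N-submodular C D = begin
    ∣ N G (C ∪ D) ∣ + ∣ N G (C ∩ D) ∣
      ≡⟨ ∣p∪q∣+∣p∩q∣≡∣p∣+∣q∣ (N G (C ∪ D)) (N G (C ∩ D)) ⟨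
    ∣ N G (C ∪ D) ∪ N G (C ∩ D) ∣ + ∣ N G (C ∪ D) ∩ N G (C ∩ D) ∣
      ≤⟨ +-mono-≤ (p⊆q⇒∣p∣≤∣q∣ (N-∪∩⊆N∪N C D)) (p⊆q⇒∣p∣≤∣q∣ (N-∪∩⊆N∩N C D)) ⟩
    ∣ N G C ∪ N G D ∣ + ∣ N G C ∩ N G D ∣
      ≡⟨ ∣p∪q∣+∣p∩q∣≡∣p∣+∣q∣ (N G C) (N G D) ⟩
    ∣ N G C ∣ + ∣ N G D ∣ ∎
    where open ≤-Reasoning

  leaving⇒meets-N : ∀ {X} x vs → Linked (Adj G) (x ∷ vs) → x ∈ X → endpoint x vs ∉ X →
                    Any (_∈ N G X) (x ∷ vs)
  leaving⇒meets-N x []       _        x∈X x∉X = ⊥-elim (x∉X x∈X)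
  leaving⇒meets-N {X} x (y ∷ ys) (xy ∷ linked) x∈X end∉X with y ∈? X
  ... | yes y∈X = there (leaving⇒meets-N y ys linked y∈X end∉X)
  ... | no  y∉X = there (here (∈N⁺ y∉X x∈X xy))

  N-leftRestrictedSeparator : ∀ {S T X} → S ⊆ X → (∀ v → v ∈ X → v ∉ T) →
                              LeftRestrictedSeparator G S T (N G X)
  N-leftRestrictedSeparator S⊆X X∩T=∅ =
    (λ s vs s∈S (linked , _) end∈T →
       leaving⇒meets-N s vs linked (S⊆X s∈S) (λ end∈X → X∩T=∅ _ end∈X end∈T)) ,
    (λ v v∈N v∈S → proj₁ (∈N⁻ v∈N) (S⊆X v∈S))

  path-prefix : ∀ {v} s vs → Any (_≡ v) (s ∷ vs) → IsPath G s vs →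
                ∃[ ys ] (IsPath G s ys × endpoint s ys ≡ v × ys L.⊆ vs)
  path-prefix s vs (here refl) _ = [] , ([-] , [] ∷ []) , refl , λ ()
  path-prefix s (y ∷ ys) (there v∈) (sy ∷ linked , s∉ ∷ unique)
    with path-prefix y ys v∈ (linked , unique)
  ... | zs , (linked′ , unique′) , end , zs⊆ys =
    y ∷ zs , (sy ∷ linked′ , anti-mono y∷zs⊆y∷ys s∉ ∷ unique′) , end , y∷zs⊆y∷ys
    where
    y∷zs⊆y∷ys : (y ∷ zs) L.⊆ (y ∷ ys)
    y∷zs⊆y∷ys (here eq)  = here eq
    y∷zs⊆y∷ys (there x∈) = there (zs⊆ys x∈)

  path-snoc : ∀ {v} s vs → IsPath G s vs → ¬ Any (_≡ v) (s ∷ vs) → Adj G (endpoint s vs) v →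
              IsPath G s (vs ++ [ v ]) × endpoint s (vs ++ [ v ]) ≡ v
  path-snoc s [] _ v∉ sv = (sv ∷ [-] , ((v∉ ∘ here) ∷ []) ∷ [] ∷ []) , refl
  path-snoc s (y ∷ ys) (sy ∷ linked , s∉ ∷ unique) v∉ end-v
    with path-snoc y ys (linked , unique) (v∉ ∘ there) end-v
  ... | (linked′ , unique′) , end = (sy ∷ linked′ , ++⁺ s∉ ((v∉ ∘ here) ∷ []) ∷ unique′) , end

  Reach-step : ∀ {S P u v} → Reach G S P u → v ∉ P → Adj G u v → Reach G S P v
  Reach-step {v = v} (s , vs , s∈S , s∉P , path , s∉P ∷ vs∉P , refl) v∉P uv
    with any? (_≟ v) (s ∷ vs)
  ... | yes v∈ with path-prefix s vs v∈ path
  ...   | ys , path′ , end , ys⊆vs = s , ys , s∈S , s∉P , path′ , s∉P ∷ anti-mono ys⊆vs vs∉P , end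
  Reach-step (s , vs , s∈S , s∉P , path , path∉P , refl) v∉P uv | no v∉
    with path-snoc s vs path v∉ uv
  ...   | path′ , end = s , vs ++ [ _ ] , s∈S , s∉P , path′ , ++⁺ path∉P (v∉P ∷ []) , end

  ∈S⇒Reach : ∀ {S P s} → (∀ v → v ∈ P → v ∉ S) → s ∈ S → Reach G S P s
  ∈S⇒Reach {P = P} {s} P∩S=∅ s∈S = s , [] , s∈S , s∉P , ([-] , [] ∷ []) , s∉P ∷ [] , refl
    where
    s∉P : s ∉ P
    s∉P s∈P = P∩S=∅ s s∈P s∈S

  N-Reach⊆P : ∀ {S P R} → (∀ v → v ∈ R ⇔ Reach G S P v) → N G R ⊆ P
  N-Reach⊆P {P = P} R≡Reach {v} v∈N with ∈N⁻ v∈N | v ∈? P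
  ... | _ , _ | yes v∈P = v∈P
  ... | v∉R , u , u∈R , uv | no v∉P =
    ⊥-elim (v∉R (Equivalence.from (R≡Reach v)
                  (Reach-step (Equivalence.to (R≡Reach u) u∈R) v∉P uv)))

lemma12 : ∀ {n} (G : Graph n) (S T P S′ C : Subset n) →
    MinLeftRestrictedSeparator G S T P →
    (∀ v → v ∈ S′ ⇔ Reach G S P v) →
    S ⊆ C → (∀ v → v ∈ C → v ∉ T) →
    ∣ N G (C ∪ S′) ∣ ≤ ∣ N G C ∣
lemma12 G S T P S′ C ((_ , P∩S=∅) , minimal) S′≡Reach S⊆C C∩T=∅ =
  +-cancelʳ-≤ ∣ N G Y ∣ _ _ (begin
    ∣ N G (C ∪ S′) ∣ + ∣ N G Y ∣ ≤⟨ N-submodular G C S′ ⟩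
    ∣ N G C ∣ + ∣ N G S′ ∣       ≤⟨ +-monoʳ-≤ ∣ N G C ∣ (p⊆q⇒∣p∣≤∣q∣ (N-Reach⊆P G S′≡Reach)) ⟩
    ∣ N G C ∣ + ∣ P ∣            ≤⟨ +-monoʳ-≤ ∣ N G C ∣ (minimal (N G Y) (N-leftRestrictedSeparator G S⊆Y Y∩T=∅)) ⟩
    ∣ N G C ∣ + ∣ N G Y ∣        ∎)
  where
  open ≤-Reasoning
  Y : Subset _
  Y = C ∩ S′
  S⊆Y : S ⊆ Y
  S⊆Y s∈S = x∈p∩q⁺ (S⊆C s∈S , Equivalence.from (S′≡Reach _) (∈S⇒Reach G P∩S=∅ s∈S))
  Y∩T=∅ : ∀ v → v ∈ Y → v ∉ T
  Y∩T=∅ v v∈Y = C∩T=∅ v (proj₁ (x∈p∩q⁻ C S′ v∈Y))
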